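{- Let $S_n$ be a good orientable sequence of order $n$ with odd weight and period $m_n$. For $i\ge n$ recursively let $S_{i+1}=\mathcal{E}(T_i)$ where $T_i\in D^{ -1}(S_i)$, and let $m_i$ be the period of $S_i$. Then for every $j\ge 0$: (a) if $m_n$ is odd, $m_{n+2j}=2^{2j}m_n+(2^{2j}-1)/3$ and $m_{n+2j+1}=2^{2j+1}m_n+(2^{2j+1}-2)/3$; (b) if $m_n$ is even, $m_{n+2j}=2^{2j}m_n+(2^{2j+1}-2)/3$ and $m_{n+2j+1}=2^{2j+1}m_n+(2^{2j+2}-1)/3$.
   Context: A periodic binary sequence $S=(s_i)$ has period $m$ = least $m>0$ with $s_{i+m}=s_i$ for all $i$; its generating cycle $[s_0,\dots,s_{m-1}]$ determines it. $\mathbf{s}_k(i)=(s_i,\dots,s_{i+k-1})$; $0^k$, $1^k$ denote tuples of $k$ zeros/ones. Weight $w(S)=\sum_{i=0}^{m-1}s_i$. Reverse of $(u_0,\dots,u_{n-1})$ is $(u_{n-1},\dots,u_0)$, written $\mathbf{u}^R$. An orientable sequence of order $n$ is a periodic binary sequence of period $m$ with $\mathbf{s}_n(i)=\mathbf{s}_n(j)\Rightarrow i\equiv j\pmod m$ and $\mathbf{s}_n(i)\ne\mathbf{s}_n(j)^R$ for all $i,j$. It is good if $0^{n-4}$ occurs exactly once in a period. Lempel map: $D((t_i))=(t_i\oplus t_{i+1})$; $D^{ -1}(S)$ is the set of periodic binary sequences $T$ with $D(T)=S$. Extension map $\mathcal{E}$ on an orientable sequence $U$ of order $k$, period $p$,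 with exactly one occurrence of $1^{k-4}$ per period: $\mathcal{E}(U)=U$ if $w(U)$ is odd; otherwise, writing the generating cycle $[u_0,\dots,u_{p-1}]$ with $u_r=\dots=u_{r+k-5}=1$ (the unique run), $\mathcal{E}(U)$ has generating cycle $[u_0,\dots,u_{r-1},1,u_r,\dots,u_{p-1}]$. -}

module Defs where

open import Data.Bool using (Bool; true; false; if_then_else_; _xor_)
open import Data.Nat using (ℕ; zero; suc; _+_; _*_; _∸_; _<_; _<ᵇ_; _≡ᵇ_; ∣_-_∣; _%_)
open import Data.Nat.Divisibility using (_∣_)
open import Data.Fin using (toℕ)
open import Data.Vec using (Vec; tabulate; reverse; replicate)
open import Data.List using (map; upTo)
open import Data.Nat.ListAction using (sum)
open import Data.Product using (Σ; _×_)
open import Relation.Binary.PropositionalEquality using (_≡_; _≢_)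
open import Relation.Nullary using (¬_)

-- A binary sequence, indexed by ℕ (periodic sequences are determined by
-- their values at non-negative indices).
Seq : Set
Seq = ℕ → Bool

IsPeriod : Seq → ℕ → Set
IsPeriod s m = (0 < m) × (∀ i → s (i + m) ≡ s i)

HasPeriod : Seq → ℕ → Set
HasPeriod s m = IsPeriod s m × (∀ k → 0 < k → k < m → ¬ IsPeriod s k)

Periodic : Seq → Set
Periodic s = Σ ℕ λ m → IsPeriod s m

window : (k : ℕ) → Seq → ℕ → Vec Bool k
window k s i = tabulate (λ j → s (i + toℕ j))

_≡_[mod_] : ℕ → ℕ → ℕ → Set
i ≡ j [mod m ] = m ∣ ∣ i - j ∣

Orientable : ℕ → Seq → ℕ → Set
Orientable n s m =
  HasPeriod s m ×
  (∀ i j → window n s i ≡ window n s j → i ≡ j [mod m ]) ×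
  (∀ i j → window n s i ≢ reverse (window n s j))

UniqueOccAt : ℕ → Bool → Seq → ℕ → ℕ → Set
UniqueOccAt k b s m r =
  (r < m) × (window k s r ≡ replicate k b) ×
  (∀ r′ → r′ < m → window k s r′ ≡ replicate k b → r′ ≡ r)

OccursOnce : ℕ → Bool → Seq → ℕ → Set
OccursOnce k b s m = Σ ℕ λ r → UniqueOccAt k b s m r

Good : ℕ → Seq → ℕ → Set
Good n s m = OccursOnce (n ∸ 4) false s m

weight : Seq → ℕ → ℕ
weight s m = sum (map (λ i → if s i then 1 else 0) (upTo m))

D : Seq → Seq
D t i = t i xor t (suc i)

InDInv : Seq → Seq → Set
InDInv t s = Periodic t × (∀ i → D t i ≡ s i)

-- the sequence with generating cycle [u_0,…,u_{r-1},1,u_r,…,u_{p-1}]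
insertOne : Seq → (p r : ℕ) → Seq
insertOne u p r i =
  let q = i % suc p in
  if q <ᵇ r then u q else (if q ≡ᵇ r then true else u (q ∸ 1))

-- V = E(U), for U of order k (E only defined when 1^{k-4} occurs exactly
-- once per period, at position r)
IsExt : ℕ → Seq → Seq → Set
IsExt k u v = Σ ℕ λ p → Σ ℕ λ r →
  HasPeriod u p × UniqueOccAt (k ∸ 4) true u p r ×
  (weight u p % 2 ≡ 1 → ∀ i → v i ≡ u i) ×
  (weight u p % 2 ≡ 0 → ∀ i → v i ≡ insertOne u p r i)

{-# OPTIONS --safe #-}
-- If S has least period m and odd weight, any T with D T = S satisfies T (x + m) = not (T x),
-- so T has least period 2m and weight ≡ m (mod 2). When m is odd, E leaves T alone; when m
-- is even, E inserts a 1 next to the unique run 1^(k-4), which gives least period 2m + 1 and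
-- odd weight again. So the periods evolve by m ↦ 2m or 2m + 1 according to the parity of m,
-- i.e. by m ↦ 4m + 1 or 4m + 2 over two steps, and the closed forms follow.
module Submission where

open import Defs
open import Data.Bool using (Bool; true; false; not; _xor_; if_then_else_)
open import Data.Bool.Properties
  using (xor-assoc; xor-comm; xor-same; xor-identityʳ; not-involutive; not-¬; not-distribˡ-xor; not-distribʳ-xor)
open import Data.Nat
  using (ℕ; zero; suc; _+_; _*_; _∸_; _^_; _%_; _<_; _≤_; _<ᵇ_; _≡ᵇ_; _<?_; _≤?_; s≤s; z<s; NonZero; >-nonZero)
open import Data.Nat.Properties
  using ( suc-injective; 1+n≢0; <⇒≤; <⇒≢; ≮⇒≥; ≰⇒>; <-cmp; <-irrefl; <-trans; <-≤-trans; m<n⇒m<1+n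
        ; +-assoc; +-comm; +-suc; +-identityʳ; +-cancelˡ-≡; +-cancelʳ-<; +-monoʳ-<; +-mono-<; +-mono-≤
        ; m≤m+n; m<m+n; m∸n+n≡m; m+n∸n≡m; m<n⇒0<n∸m; ∸-monoˡ-<; *-comm; *-suc; *-identityʳ; ^-*-assoc
        ; ≡ᵇ⇒≡; ≡⇒≡ᵇ; <ᵇ-reflects-<; +-commutativeSemigroup)
open import Algebra.Properties.CommutativeSemigroup +-commutativeSemigroup using (xy∙z≈xz∙y)
open import Data.Nat.DivMod using (_/_; [m+n]%n≡m%n; m%n<n; m*n/n≡m; m<n⇒m%n≡m; m≡m%n+[m/n]*n)
open import Data.Nat.Tactic.RingSolver using (solve-∀)
open import Data.Nat.ListAction using (sum)
open import Data.List using (map; applyUpTo)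
open import Data.Fin using (toℕ; fromℕ<)
open import Data.Fin.Properties using (toℕ-fromℕ<; toℕ<n)
open import Data.Vec using (lookup; replicate)
open import Data.Vec.Properties using (lookup-replicate; lookup∘tabulate; tabulate-cong; tabulate∘lookup)
open import Data.Product using (_×_; _,_; proj₁; proj₂)
open import Function using (_∘_; id)
open import Relation.Nullary using (¬_; yes; no; contradiction)
open import Relation.Nullary.Reflects using (Reflects; ofʸ; ofⁿ; fromEquivalence)
open import Relation.Binary.Definitions using (tri<; tri≈; tri>)
open import Relation.Binary.PropositionalEquality
open ≡-Reasoning

parity : ℕ → Bool
parity zero    = false
parity (suc n) = not (parity n)

bit : Bool → ℕ
bit b = if b then 1 else 0

bit-injective : ∀ {a b} → bit a ≡ bit b → a ≡ b
bit-injective {false} {false} _ = refl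
bit-injective {true}  {true}  _ = refl
bit-injective {false} {true}  ()
bit-injective {true}  {false} ()

parity-bit : ∀ b → parity (bit b) ≡ b
parity-bit false = refl
parity-bit true  = refl

parity-+ : ∀ m n → parity (m + n) ≡ parity m xor parity n
parity-+ zero    n = refl
parity-+ (suc m) n = trans (cong not (parity-+ m n)) (not-distribˡ-xor (parity m) (parity n))

parity-double : ∀ n → parity (n + n) ≡ false
parity-double n = trans (parity-+ n n) (xor-same (parity n))

%2≡bit∘parity : ∀ n → n % 2 ≡ bit (parity n)
%2≡bit∘parity zero          = refl
%2≡bit∘parity (suc zero)    = refl
%2≡bit∘parity (suc (suc n)) = begin
  (2 + n) % 2           ≡⟨ cong (_% 2) (+-comm 2 n) ⟩
  (n + 2) % 2           ≡⟨ [m+n]%n≡m%n n 2 ⟩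
  n % 2                 ≡⟨ %2≡bit∘parity n ⟩
  bit (parity n)        ≡⟨ cong bit (sym (not-involutive (parity n))) ⟩
  bit (parity (2 + n))  ∎

xor-involutiveˡ : ∀ a b → a xor (a xor b) ≡ b
xor-involutiveˡ false b = refl
xor-involutiveˡ true  b = not-involutive b

xor-cancelˡ : ∀ a {b c} → a xor b ≡ a xor c → b ≡ c
xor-cancelˡ a {b} {c} eq =
  trans (sym (xor-involutiveˡ a b)) (trans (cong (a xor_) eq) (xor-involutiveˡ a c))

xorSum : (ℕ → Bool) → ℕ → Bool
xorSum f zero    = false
xorSum f (suc n) = f 0 xor xorSum (f ∘ suc) n

parity-sum-applyUpTo : ∀ (f : ℕ → Bool) (g : ℕ → ℕ) n →
  parity (sum (map (bit ∘ f) (applyUpTo g n))) ≡ xorSum (f ∘ g) n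
parity-sum-applyUpTo f g zero    = refl
parity-sum-applyUpTo f g (suc n) =
  trans (parity-+ (bit (f (g 0))) _)
        (cong₂ _xor_ (parity-bit (f (g 0))) (parity-sum-applyUpTo f (g ∘ suc) n))

weight-%2 : ∀ s m → weight s m % 2 ≡ bit (xorSum s m)
weight-%2 s m = trans (%2≡bit∘parity (weight s m)) (cong bit (parity-sum-applyUpTo s id m))

xorSum-cong : ∀ {f g} n → (∀ j → j < n → f j ≡ g j) → xorSum f n ≡ xorSum g n
xorSum-cong zero    _  = refl
xorSum-cong (suc n) eq = cong₂ _xor_ (eq 0 z<s) (xorSum-cong n (λ j j<n → eq (suc j) (s≤s j<n)))

xorSum-suc : ∀ f n → xorSum f (suc n) ≡ xorSum f n xor f n
xorSum-suc f zero    = xor-comm (f 0) false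
xorSum-suc f (suc n) =
  trans (cong (f 0 xor_) (xorSum-suc (f ∘ suc) n)) (sym (xor-assoc (f 0) _ _))

xorSum-+ : ∀ f m n → xorSum f (m + n) ≡ xorSum f m xor xorSum (λ i → f (m + i)) n
xorSum-+ f zero    n = refl
xorSum-+ f (suc m) n =
  trans (cong (f 0 xor_) (xorSum-+ (f ∘ suc) m n)) (sym (xor-assoc (f 0) _ _))

xorSum-not : ∀ f n → xorSum (not ∘ f) n ≡ xorSum f n xor parity n
xorSum-not f zero    = refl
xorSum-not f (suc n) = begin
  not (f 0) xor xorSum (not ∘ f ∘ suc) n          ≡⟨ cong (not (f 0) xor_) (xorSum-not (f ∘ suc) n) ⟩
  not (f 0) xor (xorSum (f ∘ suc) n xor parity n)  ≡⟨ sym (not-distribˡ-xor (f 0) _) ⟩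
  not (f 0 xor (xorSum (f ∘ suc) n xor parity n))  ≡⟨ cong not (sym (xor-assoc (f 0) _ _)) ⟩
  not (xorSum f (suc n) xor parity n)              ≡⟨ not-distribʳ-xor (xorSum f (suc n)) (parity n) ⟩
  xorSum f (suc n) xor not (parity n)              ∎

xorSum-rotate : ∀ {f m} → (∀ i → f (i + m) ≡ f i) → ∀ a → xorSum (λ i → f (a + i)) m ≡ xorSum f m
xorSum-rotate         per zero    = refl
xorSum-rotate {f} {m} per (suc a) = trans (xorSum-rotate {f ∘ suc} (per ∘ suc) a) rotate-once
  where
  rotate-once : xorSum (f ∘ suc) m ≡ xorSum f m
  rotate-once = xor-cancelˡ (f 0) (begin
    xorSum f (suc m)    ≡⟨ xorSum-suc f m ⟩
    xorSum f m xor f m  ≡⟨ cong (xorSum f m xor_) (per 0) ⟩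
    xorSum f m xor f 0  ≡⟨ xor-comm _ (f 0) ⟩
    f 0 xor xorSum f m  ∎)

periodic-* : ∀ {A : Set} {f : ℕ → A} {p} → (∀ i → f (i + p) ≡ f i) → ∀ x k → f (x + k * p) ≡ f x
periodic-* {f = f}         per x zero    = cong f (+-identityʳ x)
periodic-* {f = f} {p = p} per x (suc k) =
  trans (cong f (shuffle x p (k * p))) (trans (per (x + k * p)) (periodic-* per x k))
  where
  shuffle : ∀ a b c → a + (b + c) ≡ a + c + b
  shuffle = solve-∀

hasPeriod-unique : ∀ {s a b} → HasPeriod s a → HasPeriod s b → a ≡ b
hasPeriod-unique {a = a} {b} (a-period , a-least) (b-period , b-least) with <-cmp a b
... | tri< a<b _ _ = contradiction a-period (b-least a (proj₁ a-period) a<b)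
... | tri≈ _ a≡b _ = a≡b
... | tri> _ _ b<a = contradiction b-period (a-least b (proj₁ b-period) b<a)

isPeriod-≗ : ∀ {s t m} → s ≗ t → IsPeriod s m → IsPeriod t m
isPeriod-≗ s≗t (m>0 , per) = m>0 , λ i → trans (sym (s≗t _)) (trans (per i) (s≗t i))

hasPeriod-≗ : ∀ {s t m} → s ≗ t → HasPeriod s m → HasPeriod t m
hasPeriod-≗ s≗t (period , least) =
  isPeriod-≗ s≗t period , λ k k>0 k<m → least k k>0 k<m ∘ isPeriod-≗ (sym ∘ s≗t)

isPeriod-∸ : ∀ {s m k} → IsPeriod s m → IsPeriod s k → m < k → IsPeriod s (k ∸ m)
isPeriod-∸ {s} {m} {k} (_ , m-per) (_ , k-per) m<k = m<n⇒0<n∸m m<k , λ i → begin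
  s (i + (k ∸ m))      ≡⟨ sym (m-per _) ⟩
  s (i + (k ∸ m) + m)  ≡⟨ cong s (trans (+-assoc i (k ∸ m) m) (cong (i +_) (m∸n+n≡m (<⇒≤ m<k)))) ⟩
  s (i + k)            ≡⟨ k-per i ⟩
  s i                  ∎

RunAt : ℕ → Bool → Seq → ℕ → Set
RunAt k b s x = ∀ t → t < k → s (x + t) ≡ b

window⇒RunAt : ∀ {k b s x} → window k s x ≡ replicate k b → RunAt k b s x
window⇒RunAt {k} {b} {s} {x} eq t t<k = begin
  s (x + t)                                      ≡⟨ cong (λ i → s (x + i)) (sym (toℕ-fromℕ< t<k)) ⟩
  s (x + toℕ (fromℕ< t<k))                       ≡⟨ sym (lookup∘tabulate _ (fromℕ< t<k)) ⟩
  lookup (window k s x) (fromℕ< t<k)             ≡⟨ cong (λ w → lookup w (fromℕ< t<k)) eq ⟩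
  lookup (replicate k b) (fromℕ< t<k)            ≡⟨ lookup-replicate (fromℕ< t<k) b ⟩
  b                                              ∎

RunAt⇒window : ∀ {k b s x} → RunAt k b s x → window k s x ≡ replicate k b
RunAt⇒window {k} {b} run =
  trans (tabulate-cong (λ j → trans (run (toℕ j) (toℕ<n j)) (sym (lookup-replicate j b))))
        (tabulate∘lookup (replicate k b))

RunAt-% : ∀ {s p k b x} .{{_ : NonZero p}} → (∀ i → s (i + p) ≡ s i) → RunAt k b s x → RunAt k b s (x % p)
RunAt-% {s} {p} {x = x} per run t t<k = begin
  s (x % p + t)              ≡⟨ sym (periodic-* per (x % p + t) (x / p)) ⟩
  s (x % p + t + x / p * p)  ≡⟨ cong s (xy∙z≈xz∙y (x % p) t (x / p * p)) ⟩
  s (x % p + x / p * p + t)  ≡⟨ cong (λ y → s (y + t)) (sym (m≡m%n+[m/n]*n x p)) ⟩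
  s (x + t)                  ≡⟨ run t t<k ⟩
  _                          ∎

[m+n]%o≡m⇒n≡0 : ∀ {m n o} .{{_ : NonZero o}} → m < o → n < o → (m + n) % o ≡ m → n ≡ 0
[m+n]%o≡m⇒n≡0 {m} {n} {o} m<o n<o eq with m + n <? o
... | yes m+n<o = +-cancelˡ-≡ m n 0 (trans (trans (sym (m<n⇒m%n≡m m+n<o)) eq) (sym (+-identityʳ m)))
... | no  m+n≮o = contradiction (+-cancelˡ-≡ m n o (trans (sym w+o≡m+n) (cong (_+ o) w≡m))) (<⇒≢ n<o)
  where
  w = m + n ∸ o
  w+o≡m+n : w + o ≡ m + n
  w+o≡m+n = m∸n+n≡m (≮⇒≥ m+n≮o)
  w<o : w < o
  w<o = +-cancelʳ-< o w o (subst (_< o + o) (sym w+o≡m+n) (+-mono-< m<o n<o))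
  w≡m : w ≡ m
  w≡m = trans (sym (m<n⇒m%n≡m w<o)) (trans (sym ([m+n]%n≡m%n w o)) (trans (cong (_% o) w+o≡m+n) eq))

D-xorSum : ∀ {t s} → D t ≗ s → ∀ n → t n ≡ t 0 xor xorSum s n
D-xorSum         Dt≗s zero    = sym (xor-identityʳ _)
D-xorSum {t} {s} Dt≗s (suc n) = begin
  t (suc n)                              ≡⟨ D-xorSum {t ∘ suc} {s ∘ suc} (Dt≗s ∘ suc) n ⟩
  t 1 xor xorSum (s ∘ suc) n             ≡⟨ cong (_xor xorSum (s ∘ suc) n) t₁ ⟩
  (t 0 xor s 0) xor xorSum (s ∘ suc) n   ≡⟨ xor-assoc (t 0) (s 0) _ ⟩
  t 0 xor xorSum s (suc n)               ∎
  where
  t₁ : t 1 ≡ t 0 xor s 0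
  t₁ = trans (sym (xor-involutiveˡ (t 0) (t 1))) (cong (t 0 xor_) (Dt≗s 0))

isPeriod-D : ∀ {t s k} → D t ≗ s → IsPeriod t k → IsPeriod s k
isPeriod-D {t} {s} {k} Dt≗s (k>0 , per) =
  k>0 , λ i → trans (sym (Dt≗s (i + k))) (trans (cong₂ _xor_ (per i) (per (suc i))) (Dt≗s i))

module Preimage {t s : Seq} {m} (Dt≗s : D t ≗ s) (s-period : HasPeriod s m) (s-odd : xorSum s m ≡ true) where

  private
    s-periodic : ∀ i → s (i + m) ≡ s i
    s-periodic = proj₂ (proj₁ s-period)

  D⁻¹-antiperiodic : ∀ x → t (x + m) ≡ not (t x)
  D⁻¹-antiperiodic x = begin
    t (x + m)                                ≡⟨ D-xorSum {λ i → t (x + i)} {λ i → s (x + i)} shifted-D m ⟩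
    t (x + 0) xor xorSum (λ i → s (x + i)) m ≡⟨ cong₂ _xor_ (cong t (+-identityʳ x)) (trans (xorSum-rotate s-periodic x) s-odd) ⟩
    t x xor true                             ≡⟨ xor-comm (t x) true ⟩
    not (t x)                                ∎
    where
    shifted-D : ∀ i → t (x + i) xor t (x + suc i) ≡ s (x + i)
    shifted-D i = trans (cong (λ y → t (x + i) xor t y) (+-suc x i)) (Dt≗s (x + i))

  D⁻¹-xorSum : xorSum t (m + m) ≡ parity m
  D⁻¹-xorSum = begin
    xorSum t (m + m)                              ≡⟨ xorSum-+ t m m ⟩
    xorSum t m xor xorSum (λ i → t (m + i)) m     ≡⟨ cong (xorSum t m xor_) second-half ⟩
    xorSum t m xor (xorSum t m xor parity m)      ≡⟨ xor-involutiveˡ (xorSum t m) (parity m) ⟩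
    parity m                                      ∎
    where
    second-half : xorSum (λ i → t (m + i)) m ≡ xorSum t m xor parity m
    second-half = trans (xorSum-cong m (λ j _ → trans (cong t (+-comm m j)) (D⁻¹-antiperiodic j)))
                        (xorSum-not t m)

  D⁻¹-hasPeriod : HasPeriod t (m + m)
  D⁻¹-hasPeriod = (<-≤-trans m>0 (m≤m+n m m) , t-periodic) , least
    where
    m>0 = proj₁ (proj₁ s-period)
    t-periodic : ∀ i → t (i + (m + m)) ≡ t i
    t-periodic i = begin
      t (i + (m + m))  ≡⟨ cong t (sym (+-assoc i m m)) ⟩
      t (i + m + m)    ≡⟨ D⁻¹-antiperiodic (i + m) ⟩
      not (t (i + m))  ≡⟨ cong not (D⁻¹-antiperiodic i) ⟩
      not (not (t i))  ≡⟨ not-involutive (t i) ⟩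
      t i              ∎
    least : ∀ k → 0 < k → k < m + m → ¬ IsPeriod t k
    least k k>0 k<2m t-period with <-cmp k m
    ... | tri< k<m _ _ = proj₂ s-period k k>0 k<m (isPeriod-D Dt≗s t-period)
    ... | tri≈ _ refl _ = not-¬ (proj₂ t-period 0) (D⁻¹-antiperiodic 0)
    ... | tri> _ _ m<k = proj₂ s-period (k ∸ m) (m<n⇒0<n∸m m<k) k∸m<m
                           (isPeriod-∸ (proj₁ s-period) (isPeriod-D Dt≗s t-period) m<k)
      where
      k∸m<m : k ∸ m < m
      k∸m<m = subst (k ∸ m <_) (m+n∸n≡m m m) (∸-monoˡ-< k<2m (<⇒≤ m<k))

open Preimage using (D⁻¹-xorSum; D⁻¹-hasPeriod)

≡ᵇ-reflects-≡ : ∀ m n → Reflects (m ≡ n) (m ≡ᵇ n)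
≡ᵇ-reflects-≡ m n = fromEquivalence (≡ᵇ⇒≡ m n) (≡⇒≡ᵇ m n)

module Insertion (u : Seq) (p r : ℕ) where

  v : Seq
  v = insertOne u p r

  slot : ℕ → Bool
  slot q = if q <ᵇ r then u q else (if q ≡ᵇ r then true else u (q ∸ 1))

  slot-< : ∀ {q} → q < r → slot q ≡ u q
  slot-< {q} q<r with q <ᵇ r | <ᵇ-reflects-< q r
  ... | true  | _        = refl
  ... | false | ofⁿ q≮r = contradiction q<r q≮r

  slot-≡ : slot r ≡ true
  slot-≡ with r <ᵇ r | <ᵇ-reflects-< r r | r ≡ᵇ r | ≡ᵇ-reflects-≡ r r
  ... | true  | ofʸ r<r | _     | _        = contradiction r<r (<-irrefl refl)
  ... | false | _       | true  | _        = refl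
  ... | false | _       | false | ofⁿ r≢r = contradiction refl r≢r

  slot-> : ∀ {q} → r < q → slot q ≡ u (q ∸ 1)
  slot-> {q} r<q with q <ᵇ r | <ᵇ-reflects-< q r | q ≡ᵇ r | ≡ᵇ-reflects-≡ q r
  ... | true  | ofʸ q<r | _     | _        = contradiction q<r (<-irrefl refl ∘ <-trans r<q)
  ... | false | _       | true  | ofʸ q≡r = contradiction (sym q≡r) (<⇒≢ r<q)
  ... | false | _       | false | _        = refl

  insertOne-periodic : ∀ x → v (x + suc p) ≡ v x
  insertOne-periodic x = cong slot ([m+n]%n≡m%n x (suc p))

  module _ (u-periodic : ∀ i → u (i + p) ≡ u i) (r<p : r < p) where

    insertOne-at : v r ≡ true
    insertOne-at = trans (cong slot (m<n⇒m%n≡m (m<n⇒m<1+n r<p))) slot-≡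

    insertOne-after : ∀ j → j < p → v (r + suc j) ≡ u (r + j)
    insertOne-after j j<p with r + suc j <? suc p
    ... | yes in-cycle = begin
      v (r + suc j)      ≡⟨ cong slot (m<n⇒m%n≡m in-cycle) ⟩
      slot (r + suc j)   ≡⟨ slot-> (m<m+n r z<s) ⟩
      u (r + suc j ∸ 1)  ≡⟨ cong (λ q → u (q ∸ 1)) (+-suc r j) ⟩
      u (r + j)          ∎
    ... | no wraps = begin
      v (r + suc j)  ≡⟨ cong v (sym (m∸n+n≡m (≮⇒≥ wraps))) ⟩
      v (y + suc p)  ≡⟨ insertOne-periodic y ⟩
      v y            ≡⟨ cong slot (m<n⇒m%n≡m (<-trans y<r (m<n⇒m<1+n r<p))) ⟩
      slot y         ≡⟨ slot-< y<r ⟩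
      u y            ≡⟨ sym (u-periodic y) ⟩
      u (y + p)      ≡⟨ cong u y+p≡r+j ⟩
      u (r + j)      ∎
      where
      y = r + suc j ∸ suc p
      y+p≡r+j : y + p ≡ r + j
      y+p≡r+j = suc-injective (trans (sym (+-suc y p)) (trans (m∸n+n≡m (≮⇒≥ wraps)) (+-suc r j)))
      y<r : y < r
      y<r = +-cancelʳ-< p y r (subst (_< r + p) (sym y+p≡r+j) (+-monoʳ-< r j<p))

    xorSum-insertOne : xorSum v (suc p) ≡ not (xorSum u p)
    xorSum-insertOne = begin
      xorSum v (suc p)                               ≡⟨ sym (xorSum-rotate insertOne-periodic r) ⟩
      v (r + 0) xor xorSum (λ i → v (r + suc i)) p   ≡⟨ cong₂ _xor_ (trans (cong v (+-identityʳ r)) insertOne-at)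
                                                                     (xorSum-cong p insertOne-after) ⟩
      not (xorSum (λ i → u (r + i)) p)               ≡⟨ cong not (xorSum-rotate u-periodic r) ⟩
      not (xorSum u p)                               ∎

    -- The inserted 1 lengthens the unique run 1^L of u into a run 1^(L+1) of v; a
    -- shorter period of v would therefore produce a second run 1^L in u.
    module _ {L} (1<p : 1 < p) (run : RunAt L true u r)
             (run-unique : ∀ r′ → r′ < p → RunAt L true u r′ → r′ ≡ r) where

      private instance
        p-nonZero : NonZero p
        p-nonZero = >-nonZero (<-trans z<s 1<p)

      no-full-run : ¬ RunAt p true u r
      no-full-run full = 1+n≢0 ([m+n]%o≡m⇒n≡0 r<p 1<p (run-unique _ (m%n<n (r + 1) p) next-run))
        where
        everywhere : ∀ y → u (r + y) ≡ true
        everywhere y = begin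
          u (r + y)                    ≡⟨ cong (λ z → u (r + z)) (m≡m%n+[m/n]*n y p) ⟩
          u (r + (y % p + y / p * p))  ≡⟨ cong u (sym (+-assoc r _ _)) ⟩
          u (r + y % p + y / p * p)    ≡⟨ periodic-* u-periodic _ (y / p) ⟩
          u (r + y % p)                ≡⟨ full (y % p) (m%n<n y p) ⟩
          true                         ∎
        next-run : RunAt L true u ((r + 1) % p)
        next-run = RunAt-% u-periodic (λ t _ → trans (cong u (+-assoc r 1 t)) (everywhere (suc t)))

      no-period-one : ¬ IsPeriod v 1
      no-period-one (_ , v-per) = no-full-run λ j j<p → begin
        u (r + j)      ≡⟨ sym (insertOne-after j j<p) ⟩
        v (r + suc j)  ≡⟨ constant (r + suc j) ⟩
        v 0            ≡⟨ sym (constant r) ⟩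
        v r            ≡⟨ insertOne-at ⟩
        true           ∎
        where
        constant : ∀ x → v x ≡ v 0
        constant x = trans (cong v (sym (*-identityʳ x))) (periodic-* v-per 0 x)

      module _ (L<p : L < p) where

        insertOne-run : ∀ t → t ≤ L → v (r + t) ≡ true
        insertOne-run zero    _   = trans (cong v (+-identityʳ r)) insertOne-at
        insertOne-run (suc t) t<L = trans (insertOne-after t (<-trans t<L L<p)) (run t t<L)

        shifted-run : ∀ {e} → IsPeriod v (suc e) → e < p → RunAt L true u (r + e)
        shifted-run {e} (_ , v-per) e<p t t<L with e + t <? p
        ... | yes e+t<p = begin
          u (r + e + t)        ≡⟨ cong u (+-assoc r e t) ⟩
          u (r + (e + t))      ≡⟨ sym (insertOne-after (e + t) e+t<p) ⟩
          v (r + suc (e + t))  ≡⟨ cong v (rearrange r e t) ⟩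
          v (r + t + suc e)    ≡⟨ v-per (r + t) ⟩
          v (r + t)            ≡⟨ insertOne-run t (<⇒≤ t<L) ⟩
          true                 ∎
          where
          rearrange : ∀ a b c → a + suc (b + c) ≡ a + c + suc b
          rearrange = solve-∀
        ... | no e+t≮p = begin
          u (r + e + t)          ≡⟨ cong u (trans (+-assoc r e t) (trans (cong (r +_) (sym w+p≡e+t)) (sym (+-assoc r w p)))) ⟩
          u (r + w + p)          ≡⟨ u-periodic (r + w) ⟩
          u (r + w)              ≡⟨ sym (insertOne-after w w<p) ⟩
          v (r + suc w)          ≡⟨ sym (insertOne-periodic (r + suc w)) ⟩
          v (r + suc w + suc p)  ≡⟨ cong v positions ⟩
          v (r + suc t + suc e)  ≡⟨ v-per (r + suc t) ⟩
          v (r + suc t)          ≡⟨ insertOne-run (suc t) t<L ⟩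
          true                   ∎
          where
          w = e + t ∸ p
          w+p≡e+t : w + p ≡ e + t
          w+p≡e+t = m∸n+n≡m (≮⇒≥ e+t≮p)
          w<p : w < p
          w<p = +-cancelʳ-< p w p (subst (_< p + p) (sym w+p≡e+t) (+-mono-< e<p (<-trans t<L L<p)))
          normalise : ∀ a b c → a + suc b + suc c ≡ suc (suc (a + (b + c)))
          normalise = solve-∀
          positions : r + suc w + suc p ≡ r + suc t + suc e
          positions = trans (normalise r w p)
                     (trans (cong (λ z → suc (suc (r + z))) (trans w+p≡e+t (+-comm e t)))
                            (sym (normalise r t e)))

        period-trivial : ∀ {e} → IsPeriod v (suc e) → e < p → e ≡ 0
        period-trivial v-period e<p = [m+n]%o≡m⇒n≡0 r<p e<p
          (run-unique _ (m%n<n _ p) (RunAt-% u-periodic (shifted-run v-period e<p)))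

      insertOne-least : ∀ d → 0 < d → d < suc p → ¬ IsPeriod v d
      insertOne-least (suc e) _ (s≤s e<p) v-period with p ≤? L
      ... | yes p≤L = no-full-run (λ j j<p → run j (<-≤-trans j<p p≤L))
      ... | no  p≰L with period-trivial (≰⇒> p≰L) v-period e<p
      ...   | refl = no-period-one v-period

      insertOne-hasPeriod : HasPeriod v (suc p)
      insertOne-hasPeriod = (z<s , insertOne-periodic) , insertOne-least

OddCycle : Seq → ℕ → Set
OddCycle s m = HasPeriod s m × xorSum s m ≡ true

next : ℕ → ℕ
next m = if parity m then m + m else suc (m + m)

extension-step : ∀ {k t s s′ m} → InDInv t s → IsExt k t s′ → OddCycle s m → OddCycle s′ (next m)
extension-step {t = t} {s} {s′} {m} (_ , Dt≗s) (p , r , t-period , (r<p , run , unique) , if-odd , if-even) (s-period , s-odd)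
  with hasPeriod-unique t-period (D⁻¹-hasPeriod Dt≗s s-period s-odd)
... | refl with parity m in m-parity
... | true  = hasPeriod-≗ s′≗t t-period , trans (xorSum-cong (m + m) (λ j _ → sym (s′≗t j))) t-odd
  where
  t-odd : xorSum t (m + m) ≡ true
  t-odd = trans (D⁻¹-xorSum Dt≗s s-period s-odd) m-parity
  s′≗t : t ≗ s′
  s′≗t i = sym (if-odd (trans (weight-%2 t (m + m)) (cong bit t-odd)) i)
... | false = hasPeriod-≗ v≗s′ v-period , trans (xorSum-cong (suc (m + m)) (λ j _ → sym (v≗s′ j))) v-odd
  where
  open Insertion t (m + m) r
  t-even : xorSum t (m + m) ≡ false
  t-even = trans (D⁻¹-xorSum Dt≗s s-period s-odd) m-parity
  v≗s′ : v ≗ s′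
  v≗s′ i = sym (if-even (trans (weight-%2 t (m + m)) (cong bit t-even)) i)
  m>0 = proj₁ (proj₁ s-period)
  v-period : HasPeriod v (suc (m + m))
  v-period = insertOne-hasPeriod (proj₂ (proj₁ t-period)) r<p (+-mono-≤ m>0 m>0) (window⇒RunAt {s = t} run)
               (λ r′ r′<p run′ → unique r′ r′<p (RunAt⇒window {s = t} run′))
  v-odd : xorSum v (suc (m + m)) ≡ true
  v-odd = trans (xorSum-insertOne (proj₂ (proj₁ t-period)) r<p) (cong not t-even)

periods : ℕ → ℕ → ℕ
periods m zero    = m
periods m (suc k) = next (periods m k)

oddCycle-chain : ∀ {n m} {S T : ℕ → Seq} → OddCycle (S n) m
  → (∀ i → n ≤ i → InDInv (T i) (S i) × IsExt (suc i) (T i) (S (suc i)))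
  → ∀ k → OddCycle (S (n + k)) (periods m k)
oddCycle-chain {n} {m} {S} start lifts zero    = subst (λ i → OddCycle (S i) m) (sym (+-identityʳ n)) start
oddCycle-chain {n} {m} {S} {T} start lifts (suc k) =
  subst (λ i → OddCycle (S i) (periods m (suc k))) (sym (+-suc n k))
        (extension-step {suc (n + k)} (proj₁ lift) (proj₂ lift) (oddCycle-chain {S = S} {T} start lifts k))
  where
  lift = lifts (n + k) (m≤m+n n k)

next-odd : ∀ x → parity x ≡ true → next x ≡ x + x
next-odd x odd rewrite odd = refl

next-even : ∀ x → parity x ≡ false → next x ≡ suc (x + x)
next-even x even rewrite even = refl

next²-odd : ∀ x → parity x ≡ true → next (next x) ≡ suc ((x + x) + (x + x))
next²-odd x odd = trans (cong next (next-odd x odd)) (next-even (x + x) (parity-double x))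

next²-even : ∀ x → parity x ≡ false → next (next x) ≡ suc (x + x) + suc (x + x)
next²-even x even = trans (cong next (next-even x even)) (next-odd (suc (x + x)) (cong not (parity-double x)))

parity-next² : ∀ x → parity (next (next x)) ≡ parity x
parity-next² x = by-parity (parity x) refl
  where
  by-parity : ∀ b → parity x ≡ b → parity (next (next x)) ≡ parity x
  by-parity true  odd  = trans (cong parity (next²-odd x odd)) (trans (cong not (parity-double (x + x))) (sym odd))
  by-parity false even = trans (cong parity (next²-even x even)) (trans (parity-double (suc (x + x))) (sym even))

next² : ∀ x → next (next x) ≡ 4 * x + (if parity x then 1 else 2)
next² x = by-parity (parity x) refl
  where
  quadruple+1 : ∀ y → suc ((y + y) + (y + y)) ≡ 4 * y + 1
  quadruple+1 = solve-∀
  quadruple+2 : ∀ y → suc (y + y) + suc (y + y) ≡ 4 * y + 2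
  quadruple+2 = solve-∀
  by-parity : ∀ b → parity x ≡ b → next (next x) ≡ 4 * x + (if parity x then 1 else 2)
  by-parity true  odd  = trans (next²-odd x odd) (trans (quadruple+1 x) (cong (λ c → 4 * x + (if c then 1 else 2)) (sym odd)))
  by-parity false even = trans (next²-even x even) (trans (quadruple+2 x) (cong (λ c → 4 * x + (if c then 1 else 2)) (sym even)))

periods-2+ : ∀ m j → periods m (2 * suc j) ≡ next (next (periods m (2 * j)))
periods-2+ m j = cong (periods m) (*-suc 2 j)

parity-periods[2j] : ∀ m j → parity (periods m (2 * j)) ≡ parity m
parity-periods[2j] m zero    = refl
parity-periods[2j] m (suc j) =
  trans (cong parity (periods-2+ m j)) (trans (parity-next² (periods m (2 * j))) (parity-periods[2j] m j))

-- repunit₄ j = 1 + 4 + … + 4^(j-1) = (4^j - 1)/3.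
repunit₄ : ℕ → ℕ
repunit₄ zero    = 0
repunit₄ (suc j) = suc (4 * repunit₄ j)

4^j≡1+3*repunit₄ : ∀ j → 4 ^ j ≡ suc (3 * repunit₄ j)
4^j≡1+3*repunit₄ zero    = refl
4^j≡1+3*repunit₄ (suc j) = trans (cong (4 *_) (4^j≡1+3*repunit₄ j)) (expand (repunit₄ j))
  where
  expand : ∀ r → 4 * suc (3 * r) ≡ suc (3 * suc (4 * r))
  expand = solve-∀

affine-iterate : ∀ (f : ℕ → ℕ) c → (∀ j → f (suc j) ≡ 4 * f j + c) → ∀ j → f j ≡ 4 ^ j * f 0 + c * repunit₄ j
affine-iterate f c step zero    = base (f 0) c
  where
  base : ∀ a b → a ≡ 1 * a + b * 0
  base = solve-∀
affine-iterate f c step (suc j) = begin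
  f (suc j)                                    ≡⟨ step j ⟩
  4 * f j + c                                  ≡⟨ cong (λ y → 4 * y + c) (affine-iterate f c step j) ⟩
  4 * (4 ^ j * f 0 + c * repunit₄ j) + c       ≡⟨ distribute (4 ^ j) (f 0) c (repunit₄ j) ⟩
  4 ^ suc j * f 0 + c * repunit₄ (suc j)       ∎
  where
  distribute : ∀ a x c r → 4 * (a * x + c * r) + c ≡ 4 * a * x + c * suc (4 * r)
  distribute = solve-∀

periods[2j] : ∀ m j → periods m (2 * j) ≡ 4 ^ j * m + (if parity m then 1 else 2) * repunit₄ j
periods[2j] m = affine-iterate (λ j → periods m (2 * j)) _ step
  where
  step : ∀ j → periods m (2 * suc j) ≡ 4 * periods m (2 * j) + (if parity m then 1 else 2)
  step j = trans (periods-2+ m j) (trans (next² (periods m (2 * j)))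
    (cong (λ b → 4 * periods m (2 * j) + (if b then 1 else 2)) (parity-periods[2j] m j)))

2^[2j]≡4^j : ∀ j → 2 ^ (2 * j) ≡ 4 ^ j
2^[2j]≡4^j j = sym (^-*-assoc 2 2 j)

2^[2j+1]≡2*4^j : ∀ j → 2 ^ (2 * j + 1) ≡ 2 * 4 ^ j
2^[2j+1]≡2*4^j j = trans (cong (2 ^_) (+-comm (2 * j) 1)) (cong (2 *_) (2^[2j]≡4^j j))

3*n/3≡n : ∀ n → 3 * n / 3 ≡ n
3*n/3≡n n = trans (cong (_/ 3) (*-comm 3 n)) (m*n/n≡m n 3)

[2^[2j]∸1]/3≡repunit₄ : ∀ j → (2 ^ (2 * j) ∸ 1) / 3 ≡ repunit₄ j
[2^[2j]∸1]/3≡repunit₄ j =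
  trans (cong (λ x → (x ∸ 1) / 3) (trans (2^[2j]≡4^j j) (4^j≡1+3*repunit₄ j))) (3*n/3≡n (repunit₄ j))

[2^[2j+1]∸2]/3≡2*repunit₄ : ∀ j → (2 ^ (2 * j + 1) ∸ 2) / 3 ≡ 2 * repunit₄ j
[2^[2j+1]∸2]/3≡2*repunit₄ j = trans (cong (λ x → (x ∸ 2) / 3) pow) (3*n/3≡n (2 * repunit₄ j))
  where
  expand : ∀ r → 2 * suc (3 * r) ≡ 2 + 3 * (2 * r)
  expand = solve-∀
  pow : 2 ^ (2 * j + 1) ≡ 2 + 3 * (2 * repunit₄ j)
  pow = trans (2^[2j+1]≡2*4^j j) (trans (cong (2 *_) (4^j≡1+3*repunit₄ j)) (expand (repunit₄ j)))

[2^[2j+2]∸1]/3≡repunit₄ : ∀ j → (2 ^ (2 * j + 2) ∸ 1) / 3 ≡ repunit₄ (suc j)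
[2^[2j+2]∸1]/3≡repunit₄ j = trans (cong (λ i → (2 ^ i ∸ 1) / 3) (twice-suc j)) ([2^[2j]∸1]/3≡repunit₄ (suc j))
  where
  twice-suc : ∀ i → 2 * i + 2 ≡ 2 * suc i
  twice-suc = solve-∀

periods[2j]-odd : ∀ {m} → parity m ≡ true → ∀ j → periods m (2 * j) ≡ 4 ^ j * m + repunit₄ j
periods[2j]-odd {m} odd j = trans (periods[2j] m j)
  (trans (cong (λ b → 4 ^ j * m + (if b then 1 else 2) * repunit₄ j) odd)
         (cong (4 ^ j * m +_) (+-identityʳ (repunit₄ j))))

periods[2j]-even : ∀ {m} → parity m ≡ false → ∀ j → periods m (2 * j) ≡ 4 ^ j * m + 2 * repunit₄ j
periods[2j]-even {m} even j = trans (periods[2j] m j)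
  (cong (λ b → 4 ^ j * m + (if b then 1 else 2) * repunit₄ j) even)

module _ {m : ℕ} where

  periods[2j]-odd-closed : parity m ≡ true → ∀ j →
    periods m (2 * j) ≡ 2 ^ (2 * j) * m + (2 ^ (2 * j) ∸ 1) / 3
  periods[2j]-odd-closed odd j = trans (periods[2j]-odd odd j)
    (cong₂ (λ a b → a * m + b) (sym (2^[2j]≡4^j j)) (sym ([2^[2j]∸1]/3≡repunit₄ j)))

  periods[2j+1]-odd-closed : parity m ≡ true → ∀ j →
    periods m (suc (2 * j)) ≡ 2 ^ (2 * j + 1) * m + (2 ^ (2 * j + 1) ∸ 2) / 3
  periods[2j+1]-odd-closed odd j = begin
    periods m (suc (2 * j))                          ≡⟨ next-odd x (trans (parity-periods[2j] m j) odd) ⟩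
    x + x                                            ≡⟨ cong (λ y → y + y) (periods[2j]-odd odd j) ⟩
    (4 ^ j * m + r) + (4 ^ j * m + r)                ≡⟨ double (4 ^ j) m r ⟩
    2 * 4 ^ j * m + 2 * r                            ≡⟨ cong₂ (λ a b → a * m + b) (sym (2^[2j+1]≡2*4^j j))
                                                              (sym ([2^[2j+1]∸2]/3≡2*repunit₄ j)) ⟩
    2 ^ (2 * j + 1) * m + (2 ^ (2 * j + 1) ∸ 2) / 3  ∎
    where
    x = periods m (2 * j)
    r = repunit₄ j
    double : ∀ a y z → (a * y + z) + (a * y + z) ≡ 2 * a * y + 2 * z
    double = solve-∀

  periods[2j]-even-closed : parity m ≡ false → ∀ j →
    periods m (2 * j) ≡ 2 ^ (2 * j) * m + (2 ^ (2 * j + 1) ∸ 2) / 3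
  periods[2j]-even-closed even j = trans (periods[2j]-even even j)
    (cong₂ (λ a b → a * m + b) (sym (2^[2j]≡4^j j)) (sym ([2^[2j+1]∸2]/3≡2*repunit₄ j)))

  periods[2j+1]-even-closed : parity m ≡ false → ∀ j →
    periods m (suc (2 * j)) ≡ 2 ^ (2 * j + 1) * m + (2 ^ (2 * j + 2) ∸ 1) / 3
  periods[2j+1]-even-closed even j = begin
    periods m (suc (2 * j))                          ≡⟨ next-even x (trans (parity-periods[2j] m j) even) ⟩
    suc (x + x)                                      ≡⟨ cong (λ y → suc (y + y)) (periods[2j]-even even j) ⟩
    suc ((4 ^ j * m + 2 * r) + (4 ^ j * m + 2 * r))  ≡⟨ double+1 (4 ^ j) m r ⟩
    2 * 4 ^ j * m + repunit₄ (suc j)                 ≡⟨ cong₂ (λ a b → a * m + b) (sym (2^[2j+1]≡2*4^j j))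
                                                              (sym ([2^[2j+2]∸1]/3≡repunit₄ j)) ⟩
    2 ^ (2 * j + 1) * m + (2 ^ (2 * j + 2) ∸ 1) / 3  ∎
    where
    x = periods m (2 * j)
    r = repunit₄ j
    double+1 : ∀ a y z → suc ((a * y + 2 * z) + (a * y + 2 * z)) ≡ 2 * a * y + suc (4 * z)
    double+1 = solve-∀

corollary3 : (n mₙ : ℕ) (S T : ℕ → Seq)
    → Orientable n (S n) mₙ → Good n (S n) mₙ → weight (S n) mₙ % 2 ≡ 1
    → (∀ i → n ≤ i → InDInv (T i) (S i) × IsExt (suc i) (T i) (S (suc i)))
    → ∀ j →
      (mₙ % 2 ≡ 1 →
        HasPeriod (S (n + 2 * j)) (2 ^ (2 * j) * mₙ + (2 ^ (2 * j) ∸ 1) / 3)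
        × HasPeriod (S (n + 2 * j + 1)) (2 ^ (2 * j + 1) * mₙ + (2 ^ (2 * j + 1) ∸ 2) / 3))
      × (mₙ % 2 ≡ 0 →
        HasPeriod (S (n + 2 * j)) (2 ^ (2 * j) * mₙ + (2 ^ (2 * j + 1) ∸ 2) / 3)
        × HasPeriod (S (n + 2 * j + 1)) (2 ^ (2 * j + 1) * mₙ + (2 ^ (2 * j + 2) ∸ 1) / 3))
corollary3 n m S T orientable _ odd-weight lifts j = odd-case , even-case
  where
  cycles : ∀ k → OddCycle (S (n + k)) (periods m k)
  cycles = oddCycle-chain {S = S} {T}
    (proj₁ orientable , bit-injective (trans (sym (weight-%2 (S n) m)) odd-weight)) lifts
  period[2j] : HasPeriod (S (n + 2 * j)) (periods m (2 * j))
  period[2j] = proj₁ (cycles (2 * j))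
  period[2j+1] : HasPeriod (S (n + 2 * j + 1)) (periods m (suc (2 * j)))
  period[2j+1] = subst (λ i → HasPeriod (S i) (periods m (suc (2 * j))))
    (sym (trans (+-assoc n (2 * j) 1) (cong (n +_) (+-comm (2 * j) 1)))) (proj₁ (cycles (suc (2 * j))))
  parity-m : ∀ {b} → m % 2 ≡ bit b → parity m ≡ b
  parity-m m%2 = bit-injective (trans (sym (%2≡bit∘parity m)) m%2)
  odd-case = λ m%2≡1 →
    subst (HasPeriod _) (periods[2j]-odd-closed (parity-m m%2≡1) j) period[2j] ,
    subst (HasPeriod _) (periods[2j+1]-odd-closed (parity-m m%2≡1) j) period[2j+1]
  even-case = λ m%2≡0 →
    subst (HasPeriod _) (periods[2j]-even-closed (parity-m m%2≡0) j) period[2j] ,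
    subst (HasPeriod _) (periods[2j+1]-even-closed (parity-m m%2≡0) j) period[2j+1]
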